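{- Let $m\ge 2$ and $s\ge 1$ be integers and let $\rho$ be a permutation of $\mathbb{Z}_{ms}$ that is semiregular of order $m$ with $s$ orbits. Then there exists a digraph with vertex set $\mathbb{Z}_{ms}$ whose automorphism group is exactly $\langle\rho\rangle$.
   Context: A permutation is semiregular if the group it generates acts with all point stabilizers trivial (all cycles have the same length, here $m$). A digraph is a binary relational structure $(V,E)$ with $E\subseteq V^2$. -}

module Defs where

open import Data.Nat using (ℕ; zero; suc; _<_)
open import Data.Fin using (Fin)
open import Data.Fin.Permutation using (Permutation′; _⟨$⟩ʳ_)
open import Data.Bool using (Bool)
open import Data.Product using (_×_; ∃)
open import Relation.Binary.PropositionalEquality using (_≡_)
open import Relation.Nullary using (¬_)

pow : ∀ {n} → Permutation′ n → ℕ → Fin n → Fin n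
pow ρ zero    x = x
pow ρ (suc k) x = ρ ⟨$⟩ʳ pow ρ k x

IsIdPow : ∀ {n} → Permutation′ n → ℕ → Set
IsIdPow ρ k = ∀ x → pow ρ k x ≡ x

HasOrder : ∀ {n} → Permutation′ n → ℕ → Set
HasOrder ρ m = IsIdPow ρ m × (∀ k → 0 < k → k < m → ¬ IsIdPow ρ k)

Semiregular : ∀ {n} → Permutation′ n → Set
Semiregular ρ = ∀ k x → pow ρ k x ≡ x → IsIdPow ρ k

SameOrbit : ∀ {n} → Permutation′ n → Fin n → Fin n → Set
SameOrbit ρ x y = ∃ λ k → pow ρ k x ≡ y

HasOrbits : ∀ {n} → Permutation′ n → ℕ → Set
HasOrbits {n} ρ s = ∃ λ (r : Fin s → Fin n) →
  (∀ i j → SameOrbit ρ (r i) (r j) → i ≡ j) × (∀ x → ∃ λ i → SameOrbit ρ (r i) x)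

Digraph : ℕ → Set
Digraph n = Fin n → Fin n → Bool

IsAut : ∀ {n} → Digraph n → Permutation′ n → Set
IsAut E σ = ∀ x y → E (σ ⟨$⟩ʳ x) (σ ⟨$⟩ʳ y) ≡ E x y

-- σ ∈ ⟨ρ⟩ (ρ has finite order, so ⟨ρ⟩ = { ρ^k : k ∈ ℕ })
InCyclic : ∀ {n} → Permutation′ n → Permutation′ n → Set
InCyclic ρ σ = ∃ λ k → ∀ x → σ ⟨$⟩ʳ x ≡ pow ρ k x

-- Fix orbit representatives r₀, …, r_{s-1}, so that every point is some ρ^a(r_i).  The
-- digraph has a loop and an arc x → ρ x at each point of the orbit of r₀, and a step arc
-- ρ^a(r_i) → ρ^a(r_{i+1}); both kinds are invariant under ρ.  An automorphism σ preserves
-- the looped orbit and commutes with ρ on it, so it agrees there with some ρ^K.  Each point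
-- has at most one outgoing step arc, so σ = ρ^K propagates from orbit i to orbit i + 1.
module Submission where

open import Defs
open import Data.Nat using (ℕ; _*_; _≤_; zero; suc; _+_; _<_)
open import Data.Nat.Properties using (+-comm; *-suc; 1+n≢n; 1+n≢0; <-trans; n<1+n) renaming (_≟_ to _≟ℕ_)
open import Data.Fin using (Fin; toℕ; fromℕ<)
open import Data.Fin.Patterns using (0F)
open import Data.Fin.Properties using (toℕ-injective; toℕ-fromℕ<; toℕ<n) renaming (_≟_ to _≟ᶠ_)
open import Data.Fin.Permutation using (Permutation′; _⟨$⟩ʳ_)
open import Data.Product using (∃; _×_; _,_; proj₁; proj₂)
open import Data.Sum using (_⊎_; inj₁; inj₂)
open import Data.Empty using (⊥-elim)
open import Function.Bundles using (_⇔_; mk⇔; Injection; Equivalence)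
open import Function.Construct.Composition using (_⇔-∘_)
open import Function.Construct.Symmetry using (⇔-sym)
open import Function.Properties.Inverse using (↔⇒↣)
open import Relation.Nullary using (Dec; does; yes; no)
open import Relation.Nullary.Decidable using (_×-dec_; _⊎-dec_; does-⇔)
open import Relation.Binary.PropositionalEquality

does-transport : ∀ {A B : Set} (a? : Dec A) (b? : Dec B) → does a? ≡ does b? → A → B
does-transport (yes _) (yes b) _  _ = b
does-transport (yes _) (no _)  () _
does-transport (no ¬a) _       _  a = ⊥-elim (¬a a)

permutation-injective : ∀ {n} (π : Permutation′ n) {x y} → π ⟨$⟩ʳ x ≡ π ⟨$⟩ʳ y → x ≡ y
permutation-injective π = Injection.injective (↔⇒↣ π)

module _ {n} (ρ : Permutation′ n) where

  pow-+ : ∀ a b x → pow ρ (a + b) x ≡ pow ρ a (pow ρ b x)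
  pow-+ zero    b x = refl
  pow-+ (suc a) b x = cong (ρ ⟨$⟩ʳ_) (pow-+ a b x)

  pow-comm : ∀ a b x → pow ρ a (pow ρ b x) ≡ pow ρ b (pow ρ a x)
  pow-comm a b x = begin
    pow ρ a (pow ρ b x) ≡⟨ pow-+ a b x ⟨
    pow ρ (a + b) x     ≡⟨ cong (λ k → pow ρ k x) (+-comm a b) ⟩
    pow ρ (b + a) x     ≡⟨ pow-+ b a x ⟩
    pow ρ b (pow ρ a x) ∎
    where open ≡-Reasoning

module _ {n m′} {ρ : Permutation′ n} (ρ^m≡id : IsIdPow ρ (suc m′)) where

  pow-*-id : ∀ c x → pow ρ (c * suc m′) x ≡ x
  pow-*-id zero    x = refl
  pow-*-id (suc c) x =
    trans (pow-+ ρ (suc m′) (c * suc m′) x) (trans (cong (pow ρ (suc m′)) (pow-*-id c x)) (ρ^m≡id x))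

  pow-inverse : ∀ b x → pow ρ (b * m′) (pow ρ b x) ≡ x
  pow-inverse b x = begin
    pow ρ (b * m′) (pow ρ b x) ≡⟨ pow-+ ρ (b * m′) b x ⟨
    pow ρ (b * m′ + b) x       ≡⟨ cong (λ k → pow ρ k x) (trans (+-comm (b * m′) b) (sym (*-suc b m′))) ⟩
    pow ρ (b * suc m′) x       ≡⟨ pow-*-id b x ⟩
    x                          ∎
    where open ≡-Reasoning

  pow-agree : Semiregular ρ → ∀ k l z → pow ρ k z ≡ pow ρ l z → ∀ w → pow ρ k w ≡ pow ρ l w
  pow-agree semiregular k l z e w = begin
    pow ρ k w                        ≡⟨ cong (pow ρ k) (pow-inverse l w) ⟨
    pow ρ k (pow ρ c (pow ρ l w))    ≡⟨ pow-comm ρ k c _ ⟩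
    pow ρ c (pow ρ k (pow ρ l w))    ≡⟨ pow-+ ρ c k _ ⟨
    pow ρ (c + k) (pow ρ l w)        ≡⟨ semiregular (c + k) z fixes-z (pow ρ l w) ⟩
    pow ρ l w                        ∎
    where
    open ≡-Reasoning
    c = l * m′
    fixes-z : pow ρ (c + k) z ≡ z
    fixes-z = trans (pow-+ ρ c k z) (trans (cong (pow ρ c) e) (pow-inverse l z))

module Construction
  {n m′ s′} (ρ : Permutation′ n) (ρ^m≡id : IsIdPow ρ (suc m′)) (semiregular : Semiregular ρ)
  (r : Fin (suc s′) → Fin n)
  (r-distinct : ∀ i j → SameOrbit ρ (r i) (r j) → i ≡ j)
  (r-covers : ∀ x → ∃ λ i → SameOrbit ρ (r i) x) where

  orbit : Fin n → Fin (suc s′)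
  orbit x = proj₁ (r-covers x)

  level : Fin n → ℕ
  level x = proj₁ (proj₂ (r-covers x))

  coordinates : ∀ x → pow ρ (level x) (r (orbit x)) ≡ x
  coordinates x = proj₂ (proj₂ (r-covers x))

  orbit-unique : ∀ a b {i j} → pow ρ a (r i) ≡ pow ρ b (r j) → i ≡ j
  orbit-unique a b {i} {j} e = r-distinct i j (b * m′ + a ,
    trans (pow-+ ρ (b * m′) a (r i)) (trans (cong (pow ρ (b * m′)) e) (pow-inverse {m′ = m′} ρ^m≡id b (r j))))

  orbit-of : ∀ a {i x} → pow ρ a (r i) ≡ x → orbit x ≡ i
  orbit-of a {x = x} e = orbit-unique (level x) a (trans (coordinates x) (sym e))

  orbit-ρ : ∀ x → orbit (ρ ⟨$⟩ʳ x) ≡ orbit x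
  orbit-ρ x = orbit-of (suc (level x)) (cong (ρ ⟨$⟩ʳ_) (coordinates x))

  -- Levels are only determined modulo m, but the point of orbit j at the level of x is not.
  atLevel : Fin n → Fin (suc s′) → Fin n
  atLevel x j = pow ρ (level x) (r j)

  atLevel-pow : ∀ a {i x} → pow ρ a (r i) ≡ x → ∀ j → atLevel x j ≡ pow ρ a (r j)
  atLevel-pow a {i} {x} e j = pow-agree {m′ = m′} ρ^m≡id semiregular (level x) a (r i) agree (r j)
    where
    agree : pow ρ (level x) (r i) ≡ pow ρ a (r i)
    agree = trans (cong (λ k → pow ρ (level x) (r k)) (sym (orbit-of a e))) (trans (coordinates x) (sym e))

  atLevel-ρ : ∀ x j → atLevel (ρ ⟨$⟩ʳ x) j ≡ ρ ⟨$⟩ʳ (atLevel x j)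
  atLevel-ρ x = atLevel-pow (suc (level x)) (cong (ρ ⟨$⟩ʳ_) (coordinates x))

  NextOrbit : Fin (suc s′) → Fin (suc s′) → Set
  NextOrbit i j = toℕ j ≡ suc (toℕ i)

  BaseArc StepArc Arc : Fin n → Fin n → Set
  BaseArc x y = orbit x ≡ 0F × (y ≡ x ⊎ y ≡ ρ ⟨$⟩ʳ x)
  StepArc x y = NextOrbit (orbit x) (orbit y) × y ≡ atLevel x (orbit y)
  Arc x y = BaseArc x y ⊎ StepArc x y

  Arc? : ∀ x y → Dec (Arc x y)
  Arc? x y = (orbit x ≟ᶠ 0F ×-dec (y ≟ᶠ x ⊎-dec y ≟ᶠ ρ ⟨$⟩ʳ x))
       ⊎-dec (toℕ (orbit y) ≟ℕ suc (toℕ (orbit x)) ×-dec y ≟ᶠ atLevel x (orbit y))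

  E : Digraph n
  E x y = does (Arc? x y)

  BaseArc-target : ∀ {x y} → BaseArc x y → orbit y ≡ 0F
  BaseArc-target     (o , inj₁ refl) = o
  BaseArc-target {x} (o , inj₂ refl) = trans (orbit-ρ x) o

  StepArc-target : ∀ {x y} → StepArc x y → orbit y ≢ 0F
  StepArc-target (next , _) o = 1+n≢0 (trans (sym next) (cong toℕ o))

  loop⇔base : ∀ {x} → Arc x x ⇔ orbit x ≡ 0F
  loop⇔base = mk⇔ loop-base (λ o → inj₁ (o , inj₁ refl))
    where
    loop-base : ∀ {x} → Arc x x → orbit x ≡ 0F
    loop-base (inj₁ (o , _))    = o
    loop-base (inj₂ (next , _)) = ⊥-elim (1+n≢n (sym next))

  StepArc-functional : ∀ {x y z} → StepArc x y → StepArc x z → y ≡ z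
  StepArc-functional {x} (next-y , y≡) (next-z , z≡) =
    trans y≡ (trans (cong (atLevel x) (toℕ-injective (trans next-y (sym next-z)))) (sym z≡))

  NextOrbit-ρ : ∀ {x y} → NextOrbit (orbit x) (orbit y) → NextOrbit (orbit (ρ ⟨$⟩ʳ x)) (orbit (ρ ⟨$⟩ʳ y))
  NextOrbit-ρ {x} {y} = subst₂ NextOrbit (sym (orbit-ρ x)) (sym (orbit-ρ y))

  NextOrbit-ρ⁻ : ∀ {x y} → NextOrbit (orbit (ρ ⟨$⟩ʳ x)) (orbit (ρ ⟨$⟩ʳ y)) → NextOrbit (orbit x) (orbit y)
  NextOrbit-ρ⁻ {x} {y} = subst₂ NextOrbit (orbit-ρ x) (orbit-ρ y)

  atLevel-orbit-ρ : ∀ x y → atLevel (ρ ⟨$⟩ʳ x) (orbit (ρ ⟨$⟩ʳ y)) ≡ ρ ⟨$⟩ʳ (atLevel x (orbit y))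
  atLevel-orbit-ρ x y = trans (cong (atLevel (ρ ⟨$⟩ʳ x)) (orbit-ρ y)) (atLevel-ρ x (orbit y))

  StepArc-ρ : ∀ {x y} → StepArc x y → StepArc (ρ ⟨$⟩ʳ x) (ρ ⟨$⟩ʳ y)
  StepArc-ρ {x} {y} (next , e) = NextOrbit-ρ next , trans (cong (ρ ⟨$⟩ʳ_) e) (sym (atLevel-orbit-ρ x y))

  Arc-ρ : ∀ {x y} → Arc x y ⇔ Arc (ρ ⟨$⟩ʳ x) (ρ ⟨$⟩ʳ y)
  Arc-ρ {x} {y} = mk⇔ forth back
    where
    ρ-injective = permutation-injective ρ
    forth : Arc x y → Arc (ρ ⟨$⟩ʳ x) (ρ ⟨$⟩ʳ y)
    forth (inj₁ (o , inj₁ e)) = inj₁ (trans (orbit-ρ x) o , inj₁ (cong (ρ ⟨$⟩ʳ_) e))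
    forth (inj₁ (o , inj₂ e)) = inj₁ (trans (orbit-ρ x) o , inj₂ (cong (ρ ⟨$⟩ʳ_) e))
    forth (inj₂ step)         = inj₂ (StepArc-ρ step)
    back : Arc (ρ ⟨$⟩ʳ x) (ρ ⟨$⟩ʳ y) → Arc x y
    back (inj₁ (o , inj₁ e))  = inj₁ (trans (sym (orbit-ρ x)) o , inj₁ (ρ-injective e))
    back (inj₁ (o , inj₂ e))  = inj₁ (trans (sym (orbit-ρ x)) o , inj₂ (ρ-injective e))
    back (inj₂ (next , e))    = inj₂ (NextOrbit-ρ⁻ next , ρ-injective (trans e (atLevel-orbit-ρ x y)))

  StepArc-pow : ∀ k {x y} → StepArc x y → StepArc (pow ρ k x) (pow ρ k y)
  StepArc-pow zero    step = step
  StepArc-pow (suc k) step = StepArc-ρ (StepArc-pow k step)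

  E-pow : ∀ k x y → E (pow ρ k x) (pow ρ k y) ≡ E x y
  E-pow zero    x y = refl
  E-pow (suc k) x y = trans (sym (does-⇔ Arc-ρ (Arc? _ _) (Arc? _ _))) (E-pow k x y)

  StepArc-predecessor : ∀ {k x} → toℕ (orbit x) ≡ suc k → ∃ λ x′ → toℕ (orbit x′) ≡ k × StepArc x′ x
  StepArc-predecessor {k} {x} h = x′ , orbit-x′ , trans h (cong suc (sym orbit-x′)) , x≡
    where
    k<s : k < suc s′
    k<s = <-trans (n<1+n k) (subst (_< suc s′) h (toℕ<n (orbit x)))
    x′ = atLevel x (fromℕ< k<s)
    orbit-x′ : toℕ (orbit x′) ≡ k
    orbit-x′ = trans (cong toℕ (orbit-of (level x) refl)) (toℕ-fromℕ< k<s)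
    x≡ : x ≡ atLevel x′ (orbit x)
    x≡ = sym (trans (atLevel-pow (level x) refl (orbit x)) (coordinates x))

  module Automorphism (σ : Permutation′ n) (aut : IsAut E σ) where

    Arc-σ : ∀ {x y} → Arc x y ⇔ Arc (σ ⟨$⟩ʳ x) (σ ⟨$⟩ʳ y)
    Arc-σ {x} {y} = mk⇔ (does-transport (Arc? x y) (Arc? _ _) (sym (aut x y)))
                        (does-transport (Arc? _ _) (Arc? x y) (aut x y))

    base-σ : ∀ {x} → orbit x ≡ 0F ⇔ orbit (σ ⟨$⟩ʳ x) ≡ 0F
    base-σ = loop⇔base ⇔-∘ (Arc-σ ⇔-∘ ⇔-sym loop⇔base)

    σ-ρ-base : ∀ {w} → orbit w ≡ 0F → σ ⟨$⟩ʳ (ρ ⟨$⟩ʳ w) ≡ ρ ⟨$⟩ʳ (σ ⟨$⟩ʳ w)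
    σ-ρ-base {w} o with Equivalence.to Arc-σ (inj₁ (o , inj₂ refl))
    ... | inj₁ (_ , inj₁ e) = trans e (sym (semiregular 1 w (permutation-injective σ e) (σ ⟨$⟩ʳ w)))
    ... | inj₁ (_ , inj₂ e) = e
    ... | inj₂ step         = ⊥-elim (StepArc-target step (Equivalence.to base-σ (trans (orbit-ρ w) o)))

    K : ℕ
    K = level (σ ⟨$⟩ʳ (r 0F))

    σ-r₀ : σ ⟨$⟩ʳ (r 0F) ≡ pow ρ K (r 0F)
    σ-r₀ = sym (trans (cong (λ i → pow ρ K (r i)) (sym o)) (coordinates _))
      where o = Equivalence.to base-σ (orbit-of 0 refl)

    σ-on-base : ∀ a → σ ⟨$⟩ʳ (pow ρ a (r 0F)) ≡ pow ρ K (pow ρ a (r 0F))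
    σ-on-base zero    = σ-r₀
    σ-on-base (suc a) = begin
      σ ⟨$⟩ʳ (ρ ⟨$⟩ʳ (pow ρ a (r 0F))) ≡⟨ σ-ρ-base (orbit-of a refl) ⟩
      ρ ⟨$⟩ʳ (σ ⟨$⟩ʳ (pow ρ a (r 0F))) ≡⟨ cong (ρ ⟨$⟩ʳ_) (σ-on-base a) ⟩
      ρ ⟨$⟩ʳ (pow ρ K (pow ρ a (r 0F))) ≡⟨ pow-comm ρ 1 K _ ⟩
      pow ρ K (pow ρ (suc a) (r 0F))    ∎
      where open ≡-Reasoning

    σ-on-orbit : ∀ k x → toℕ (orbit x) ≡ k → σ ⟨$⟩ʳ x ≡ pow ρ K x
    σ-on-orbit zero x h = trans (cong (σ ⟨$⟩ʳ_) x≡) (trans (σ-on-base (level x)) (cong (pow ρ K) (sym x≡)))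
      where
      x≡ : x ≡ pow ρ (level x) (r 0F)
      x≡ = trans (sym (coordinates x)) (cong (λ i → pow ρ (level x) (r i)) (toℕ-injective h))
    σ-on-orbit (suc k) x h with StepArc-predecessor h
    ... | x′ , h′ , step with Equivalence.to Arc-σ (inj₂ step)
    ...   | inj₂ step′ = StepArc-functional (subst (λ z → StepArc z (σ ⟨$⟩ʳ x)) (σ-on-orbit k x′ h′) step′)
                                            (StepArc-pow K step)
    ...   | inj₁ base  = ⊥-elim (StepArc-target step (Equivalence.from base-σ (BaseArc-target base)))

    σ∈⟨ρ⟩ : InCyclic ρ σ
    σ∈⟨ρ⟩ = K , λ x → σ-on-orbit _ x refl

  Aut⇔InCyclic : ∀ σ → IsAut E σ ⇔ InCyclic ρ σ
  Aut⇔InCyclic σ = mk⇔ (Automorphism.σ∈⟨ρ⟩ σ) (λ (k , σ≡) x y → trans (cong₂ E (σ≡ x) (σ≡ y)) (E-pow k x y))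

lemma2p3 : (m s : ℕ) → 2 ≤ m → 1 ≤ s → (ρ : Permutation′ (m * s)) →
    Semiregular ρ → HasOrder ρ m → HasOrbits ρ s →
    ∃ λ (E : Digraph (m * s)) → ∀ (σ : Permutation′ (m * s)) → IsAut E σ ⇔ InCyclic ρ σ
lemma2p3 (suc m′) (suc s′) _ _ ρ semiregular (ρ^m≡id , _) (r , r-distinct , r-covers) = E , Aut⇔InCyclic
  where open Construction {m′ = m′} ρ ρ^m≡id semiregular r r-distinct r-covers
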